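{- A König–Egerváry graph $G$ has every one of its edges $\alpha$-critical if and only if $G$ is isomorphic to $K_2$.
   Context: All graphs are finite and simple; "graph" means a connected graph with at least one edge. $\alpha(G)$ is the stability number, $\mu(G)$ the maximum matching size, $n(G)=|V(G)|$. $G$ is König–Egerváry if $\alpha(G)+\mu(G)=n(G)$. An edge $e$ is $\alpha$-critical if $\alpha(G-e)>\alpha(G)$, where $G-e$ is $G$ with the edge $e$ deleted. -}

module Defs where

open import Data.Nat using (ℕ; _≤_; _<_; _+_)
open import Data.Bool using (Bool; true; false; _∧_; _∨_; not)
open import Data.Fin using (Fin)
open import Data.Fin.Properties using (_≟_)
open import Data.Fin.Subset using (Subset; _∈_; ∣_∣)
open import Data.List using (List; []; _∷_; concatMap; length)
open import Data.List.Relation.Unary.All using (All)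
open import Data.List.Relation.Unary.Unique.Propositional using (Unique)
open import Data.Product using (Σ; _×_; _,_; ∃; ∃₂)
open import Function.Bundles using (_⤖_; Bijection; _⇔_)
open import Relation.Binary.PropositionalEquality using (_≡_; _≢_)
open import Relation.Binary.Construct.Closure.ReflexiveTransitive using (Star)
open import Relation.Nullary.Decidable using (⌊_⌋)

AdjRel : ℕ → Set
AdjRel n = Fin n → Fin n → Bool

Edge : ∀ {n} → AdjRel n → Fin n → Fin n → Set
Edge E x y = E x y ≡ true

Simple : ∀ {n} → AdjRel n → Set
Simple E = (∀ x → E x x ≡ false) × (∀ x y → E x y ≡ E y x)

Connected : ∀ {n} → AdjRel n → Set
Connected E = ∀ x y → Star (Edge E) x y

HasEdge : ∀ {n} → AdjRel n → Set
HasEdge E = ∃₂ λ x y → Edge E x y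

-- "graph" in the paper: connected finite simple graph with at least one edge
IsGraph : ∀ {n} → AdjRel n → Set
IsGraph E = Simple E × Connected E × HasEdge E

Stable : ∀ {n} → AdjRel n → Subset n → Set
Stable E S = ∀ x y → x ∈ S → y ∈ S → E x y ≡ false

IsAlpha : ∀ {n} → AdjRel n → ℕ → Set
IsAlpha E k = (Σ _ λ S → Stable E S × ∣ S ∣ ≡ k) × (∀ S → Stable E S → ∣ S ∣ ≤ k)

endpoints : ∀ {n} → List (Fin n × Fin n) → List (Fin n)
endpoints = concatMap (λ { (x , y) → x ∷ y ∷ [] })

Matching : ∀ {n} → AdjRel n → List (Fin n × Fin n) → Set
Matching E M = All (λ { (x , y) → Edge E x y }) M × Unique (endpoints M)

IsMu : ∀ {n} → AdjRel n → ℕ → Set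
IsMu E k = (Σ _ λ M → Matching E M × length M ≡ k) × (∀ M → Matching E M → length M ≤ k)

KonigEgervary : ∀ {n} → AdjRel n → Set
KonigEgervary {n} E = ∃₂ λ a m → IsAlpha E a × IsMu E m × a + m ≡ n

deleteEdge : ∀ {n} → AdjRel n → Fin n → Fin n → AdjRel n
deleteEdge E u v x y =
  E x y ∧ not ((⌊ x ≟ u ⌋ ∧ ⌊ y ≟ v ⌋) ∨ (⌊ x ≟ v ⌋ ∧ ⌊ y ≟ u ⌋))

AlphaCritical : ∀ {n} → AdjRel n → Fin n → Fin n → Set
AlphaCritical E u v = ∀ a b → IsAlpha E a → IsAlpha (deleteEdge E u v) b → a < b

AllEdgesAlphaCritical : ∀ {n} → AdjRel n → Set
AllEdgesAlphaCritical E = ∀ u v → Edge E u v → AlphaCritical E u v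

K₂ : AdjRel 2
K₂ x y = not ⌊ x ≟ y ⌋

Isomorphic : ∀ {n m} → AdjRel n → AdjRel m → Set
Isomorphic {n} {m} E F =
  Σ (Fin n ⤖ Fin m) λ f →
    ∀ x y → E x y ≡ F (Bijection.to f x) (Bijection.to f y)

{-# OPTIONS --safe #-}
module Submission where

-- A stable set T and a matching M of any graph satisfy |T| + |M| ≤ n, because every matched
-- edge has an endpoint outside T and these endpoints are distinct.  So in a König–Egerváry
-- graph with maximum matching M, an α-critical edge e lies in M: otherwise M survives in G - e
-- and α(G - e) ≤ n - |M| = α(G).  If every edge is α-critical, every edge lies in M; as edges
-- of a matching are disjoint, connectivity leaves only the two ends of one edge, so G ≅ K₂.
-- Conversely a complete graph has α = 1, while the ends of a deleted edge are stable in G - e.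

open import Defs
open import Data.Nat using (ℕ)
open import Function.Bundles using (_⇔_)

open import Data.Bool using (true; false; _∧_; not)
import Data.Bool.Properties as Bool
open import Data.Empty using (⊥-elim)
open import Data.Fin using (Fin; zero; suc)
open import Data.Fin.Properties using (_≟_; all?)
open import Data.Fin.Subset using (Subset; _∈_; _∉_; _∪_; ⁅_⁆; ∣_∣; ⊥)
open import Data.Fin.Subset.Properties
  using (_∈?_; ∉⊥; x∈⁅x⁆; x∈⁅y⁆⇒x≡y; x≢y⇒x∉⁅y⁆; ∣⁅x⁆∣≡1; ∣⊥∣≡0; ∣p∣≤n; p⊆q⇒∣p∣≤∣q∣; p⊂q⇒∣p∣<∣q∣;
         p⊆p∪q; q⊆p∪q; x∈p∪q⁻; nonempty?; Empty-unique; anySubset?)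
open import Data.List using (List; []; _∷_; length)
open import Data.List.Membership.Propositional using () renaming (_∈_ to _∈ₗ_; _∉_ to _∉ₗ_)
open import Data.List.Relation.Unary.All using (All; []; _∷_)
import Data.List.Relation.Unary.All as All
open import Data.List.Relation.Unary.All.Properties.Core using (¬Any⇒All¬; All¬⇒¬Any)
open import Data.List.Relation.Unary.Any using (Any; here; there; any?)
import Data.List.Relation.Unary.Any as Any
open import Data.List.Relation.Unary.AllPairs using (_∷_)
open import Data.List.Relation.Unary.Unique.Propositional using (Unique)
open import Data.Nat using (zero; suc; _+_; _≤_; _<_; z≤n; s≤s⁻¹) renaming (_≟_ to _≟ℕ_)
open import Data.Nat.Properties
  using (≤∧≢⇒<; n≤0⇒n≡0; <⇒≱; +-suc; +-identityʳ; +-monoˡ-≤; +-cancelʳ-≤; module ≤-Reasoning)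
open import Data.Product using (Σ; _×_; _,_; ∃; proj₁; proj₂)
open import Data.Sum using (_⊎_; inj₁; inj₂; [_,_])
import Data.Sum as Sum
open import Function using (_∘_)
open import Function.Bundles using (_⤖_; Bijection; mk⤖; mk⇔)
open import Function.Properties.Bijection using (sym-≡)
open import Relation.Binary.PropositionalEquality
  using (_≡_; _≢_; refl; sym; trans; subst; cong; cong₂; module ≡-Reasoning)
open import Relation.Binary.Construct.Closure.ReflexiveTransitive using (Star; ε; _◅_)
open import Relation.Nullary using (¬_; Dec; does; yes; no; contradiction)
open import Relation.Nullary.Decidable
  using (_×-dec_; _→-dec_; _⊎-dec_; dec-true; dec-false; isYes≗does; decidable-stable)

module _ {n : ℕ} where

  x∉p⇒∣p∣<∣p∪⁅x⁆∣ : ∀ {x : Fin n} {p : Subset n} → x ∉ p → ∣ p ∣ < ∣ p ∪ ⁅ x ⁆ ∣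
  x∉p⇒∣p∣<∣p∪⁅x⁆∣ {x} {p} x∉p = p⊂q⇒∣p∣<∣q∣ (p⊆p∪q ⁅ x ⁆ , x , q⊆p∪q p ⁅ x ⁆ (x∈⁅x⁆ x) , x∉p)

  x∉p⇒x≢y⇒x∉p∪⁅y⁆ : ∀ {x y : Fin n} {p : Subset n} → x ∉ p → x ≢ y → x ∉ p ∪ ⁅ y ⁆
  x∉p⇒x≢y⇒x∉p∪⁅y⁆ {x} {y} {p} x∉p x≢y = [ x∉p , x≢y⇒x∉⁅y⁆ x≢y ] ∘ x∈p∪q⁻ p ⁅ y ⁆

  x∈⁅y⁆∪⁅z⁆⇒x≡y⊎x≡z : ∀ {x y z : Fin n} → x ∈ ⁅ y ⁆ ∪ ⁅ z ⁆ → x ≡ y ⊎ x ≡ z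
  x∈⁅y⁆∪⁅z⁆⇒x≡y⊎x≡z {y = y} {z} = Sum.map (x∈⁅y⁆⇒x≡y y) (x∈⁅y⁆⇒x≡y z) ∘ x∈p∪q⁻ ⁅ y ⁆ ⁅ z ⁆

  subsingleton⇒∣p∣≤1 : ∀ (p : Subset n) → (∀ x y → x ∈ p → y ∈ p → x ≡ y) → ∣ p ∣ ≤ 1
  subsingleton⇒∣p∣≤1 p all-equal with nonempty? p
  ... | yes (x , x∈p) = subst (∣ p ∣ ≤_) (∣⁅x⁆∣≡1 x) (p⊆q⇒∣p∣≤∣q∣ p⊆⁅x⁆)
    where
    p⊆⁅x⁆ : ∀ {y} → y ∈ p → y ∈ ⁅ x ⁆
    p⊆⁅x⁆ {y} y∈p = subst (_∈ ⁅ x ⁆) (all-equal x y x∈p y∈p) (x∈⁅x⁆ x)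
  ... | no empty rewrite Empty-unique empty | ∣⊥∣≡0 n = z≤n

  MaxSize : (Subset n → Set) → ℕ → Set
  MaxSize P k = (Σ (Subset n) λ S → P S × ∣ S ∣ ≡ k) × (∀ S → P S → ∣ S ∣ ≤ k)

  maxSize-exists : ∀ {P : Subset n → Set} → (∀ S → Dec (P S)) → ∀ {S₀} → P S₀ → ∃ (MaxSize P)
  maxSize-exists {P} P? {S₀} P-S₀ = search n (λ S _ → ∣p∣≤n S)
    where
    search : ∀ j → (∀ S → P S → ∣ S ∣ ≤ j) → ∃ (MaxSize P)
    search zero bound = 0 , (S₀ , P-S₀ , n≤0⇒n≡0 (bound S₀ P-S₀)) , bound
    search (suc j) bound with anySubset? (λ S → P? S ×-dec (∣ S ∣ ≟ℕ suc j))
    ... | yes attained = suc j , attained , bound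
    ... | no ¬attained = search j λ S P-S → s≤s⁻¹ (≤∧≢⇒< (bound S P-S) (¬attained ∘ (S ,_) ∘ (P-S ,_)))

module _ {n : ℕ} where

  Loopless : AdjRel n → Set
  Loopless E = ∀ x → E x x ≡ false

  Complete : AdjRel n → Set
  Complete E = ∀ x y → x ≢ y → Edge E x y

  edge⇒≢false : ∀ {E : AdjRel n} {x y} → Edge E x y → E x y ≢ false
  edge⇒≢false exy exy-false with () ← trans (sym exy) exy-false

  loopless-edge⇒≢ : ∀ {E : AdjRel n} {x y} → Loopless E → Edge E x y → x ≢ y
  loopless-edge⇒≢ {E} loopless exy refl = edge⇒≢false {E} exy (loopless _)

  stable? : ∀ (E : AdjRel n) S → Dec (Stable E S)
  stable? E S = all? λ x → all? λ y → (x ∈? S) →-dec ((y ∈? S) →-dec (E x y Bool.≟ false))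

  α-exists : ∀ (E : AdjRel n) → ∃ (IsAlpha E)
  α-exists E = maxSize-exists (stable? E) {⊥} λ _ _ x∈⊥ _ → contradiction x∈⊥ ∉⊥

  HasEndOutside : Subset n → Fin n × Fin n → Set
  HasEndOutside T (x , y) = x ∉ T ⊎ y ∉ T

  stable-edge⇒hasEndOutside : ∀ {E : AdjRel n} {T x y} → Stable E T → Edge E x y →
    HasEndOutside T (x , y)
  stable-edge⇒hasEndOutside {E} {T} {x} {y} stable exy with x ∈? T | y ∈? T
  ... | yes x∈T | yes y∈T = contradiction (stable x y x∈T y∈T) (edge⇒≢false {E} exy)
  ... | no x∉T  | _       = inj₁ x∉T
  ... | yes _   | no y∉T  = inj₂ y∉T

  hasEndOutside-∪⁅⁆ : ∀ {T a} M → All (a ≢_) (endpoints M) →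
    All (HasEndOutside T) M → All (HasEndOutside (T ∪ ⁅ a ⁆)) M
  hasEndOutside-∪⁅⁆ [] [] [] = []
  hasEndOutside-∪⁅⁆ ((x , y) ∷ M) (a≢x ∷ a≢y ∷ a∉M) (outside ∷ rest) =
    Sum.map (λ x∉T → x∉p⇒x≢y⇒x∉p∪⁅y⁆ x∉T (a≢x ∘ sym)) (λ y∉T → x∉p⇒x≢y⇒x∉p∪⁅y⁆ y∉T (a≢y ∘ sym)) outside
      ∷ hasEndOutside-∪⁅⁆ M a∉M rest

  ∣T∣+length≤n : ∀ T (M : List (Fin n × Fin n)) → Unique (endpoints M) →
    All (HasEndOutside T) M → ∣ T ∣ + length M ≤ n
  ∣T∣+length≤n T [] _ _ = subst (_≤ n) (sym (+-identityʳ ∣ T ∣)) (∣p∣≤n T)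
  ∣T∣+length≤n T ((a , b) ∷ M) ((_ ∷ a∉M) ∷ b∉M ∷ unique) (outside ∷ rest) =
    [ (λ a∉T → add a∉T a∉M) , (λ b∉T → add b∉T b∉M) ] outside
    where
    open ≤-Reasoning
    add : ∀ {c} → c ∉ T → All (c ≢_) (endpoints M) → ∣ T ∣ + suc (length M) ≤ n
    add {c} c∉T c∉M = begin
      ∣ T ∣ + suc (length M)   ≡⟨ +-suc ∣ T ∣ (length M) ⟩
      suc ∣ T ∣ + length M     ≤⟨ +-monoˡ-≤ (length M) (x∉p⇒∣p∣<∣p∪⁅x⁆∣ c∉T) ⟩
      ∣ T ∪ ⁅ c ⁆ ∣ + length M ≤⟨ ∣T∣+length≤n (T ∪ ⁅ c ⁆) M unique (hasEndOutside-∪⁅⁆ M c∉M rest) ⟩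
      n                        ∎

  stable+matching≤n : ∀ {E : AdjRel n} {T M} → Stable E T → Matching E M → ∣ T ∣ + length M ≤ n
  stable+matching≤n {E} {T} {M} stable (edges , unique) =
    ∣T∣+length≤n T M unique (All.map (stable-edge⇒hasEndOutside {E} stable) edges)

  Joins : Fin n → Fin n → Fin n × Fin n → Set
  Joins u v (a , b) = (a ≡ u × b ≡ v) ⊎ (a ≡ v × b ≡ u)

  joins? : ∀ u v p → Dec (Joins u v p)
  joins? u v (a , b) = ((a ≟ u) ×-dec (b ≟ v)) ⊎-dec ((a ≟ v) ×-dec (b ≟ u))

  joins-sym : ∀ {u v p} → Joins u v p → Joins v u p
  joins-sym = Sum.swap

  deleteEdge≡∧¬joins : ∀ E u v a b → deleteEdge E u v a b ≡ E a b ∧ not (does (joins? u v (a , b)))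
  deleteEdge≡∧¬joins E u v a b
    rewrite isYes≗does (a ≟ u) | isYes≗does (b ≟ v) | isYes≗does (a ≟ v) | isYes≗does (b ≟ u) = refl

  deleteEdge-keeps : ∀ {E : AdjRel n} {u v a b} → ¬ Joins u v (a , b) → Edge E a b →
    Edge (deleteEdge E u v) a b
  deleteEdge-keeps {E} {u} {v} {a} {b} ¬joins eab = begin
    deleteEdge E u v a b      ≡⟨ deleteEdge≡∧¬joins E u v a b ⟩
    E a b ∧ not (does uv?)    ≡⟨ cong₂ (λ e d → e ∧ not d) eab (dec-false uv? ¬joins) ⟩
    true                      ∎
    where
    open ≡-Reasoning
    uv? = joins? u v (a , b)

  deleteEdge-removes : ∀ {E : AdjRel n} {u v a b} → Joins u v (a , b) → deleteEdge E u v a b ≡ false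
  deleteEdge-removes {E} {u} {v} {a} {b} joins = begin
    deleteEdge E u v a b      ≡⟨ deleteEdge≡∧¬joins E u v a b ⟩
    E a b ∧ not (does uv?)    ≡⟨ cong (λ d → E a b ∧ not d) (dec-true uv? joins) ⟩
    E a b ∧ false             ≡⟨ Bool.∧-zeroʳ (E a b) ⟩
    false                     ∎
    where
    open ≡-Reasoning
    uv? = joins? u v (a , b)

  deleteEdge-loopless : ∀ {E : AdjRel n} {u v} → Loopless E → Loopless (deleteEdge E u v)
  deleteEdge-loopless loopless x = cong (_∧ _) (loopless x)

  Matched : List (Fin n × Fin n) → Fin n → Fin n → Set
  Matched M u v = Any (Joins u v) M

  matching-deleteEdge : ∀ {E : AdjRel n} {M u v} → Matching E M → ¬ Matched M u v →
    Matching (deleteEdge E u v) M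
  matching-deleteEdge {E} {M} (edges , unique) unmatched =
    All.zipWith (λ (eab , ¬joins) → deleteEdge-keeps {E} ¬joins eab) (edges , ¬Any⇒All¬ M unmatched)
      , unique

  joins⇒∉ : ∀ {a b x y} {L : List (Fin n)} → a ∉ₗ L → b ∉ₗ L → Joins x y (a , b) → x ∉ₗ L
  joins⇒∉ a∉L _   (inj₁ (refl , _)) = a∉L
  joins⇒∉ _   b∉L (inj₂ (_ , refl)) = b∉L

  joins-partner-unique : ∀ {a b x y w} → a ≢ b → Joins x y (a , b) → Joins x w (a , b) → y ≡ w
  joins-partner-unique _   (inj₁ (refl , refl)) (inj₁ (_ , refl))    = refl
  joins-partner-unique a≢b (inj₁ (refl , refl)) (inj₂ (refl , refl)) = ⊥-elim (a≢b refl)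
  joins-partner-unique a≢b (inj₂ (refl , refl)) (inj₁ (refl , refl)) = ⊥-elim (a≢b refl)
  joins-partner-unique _   (inj₂ (refl , _))    (inj₂ (refl , _))    = refl

  matched⇒∈endpoints : ∀ {M x y} → Matched M x y → x ∈ₗ endpoints M
  matched⇒∈endpoints (here (inj₁ (refl , _))) = here refl
  matched⇒∈endpoints (here (inj₂ (_ , refl))) = there (here refl)
  matched⇒∈endpoints (there m) = there (there (matched⇒∈endpoints m))

  matched-partner-unique : ∀ {M x y w} → Unique (endpoints M) → Matched M x y → Matched M x w → y ≡ w
  matched-partner-unique ((a≢b ∷ _) ∷ _) (here j) (here k) = joins-partner-unique a≢b j k
  matched-partner-unique ((_ ∷ a∉M) ∷ b∉M ∷ _) (here j) (there k) =
    ⊥-elim (joins⇒∉ (All¬⇒¬Any a∉M) (All¬⇒¬Any b∉M) j (matched⇒∈endpoints k))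
  matched-partner-unique ((_ ∷ a∉M) ∷ b∉M ∷ _) (there j) (here k) =
    ⊥-elim (joins⇒∉ (All¬⇒¬Any a∉M) (All¬⇒¬Any b∉M) k (matched⇒∈endpoints j))
  matched-partner-unique (_ ∷ _ ∷ unique) (there j) (there k) = matched-partner-unique unique j k

  edges-matched⇒vertices-on-edge : ∀ {E : AdjRel n} {M x y} → Connected E → Unique (endpoints M) →
    (∀ {z w} → Edge E z w → Matched M z w) → Matched M x y → ∀ z → z ≡ x ⊎ z ≡ y
  edges-matched⇒vertices-on-edge {E} {M} {x} {y} connected unique matched mxy z =
    walk (connected x z) (inj₁ refl)
    where
    myx : Matched M y x
    myx = Any.map joins-sym mxy

    walk : ∀ {p q} → Star (Edge E) p q → p ≡ x ⊎ p ≡ y → q ≡ x ⊎ q ≡ y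
    walk ε            on-xy       = on-xy
    walk (epw ◅ path) (inj₁ refl) = walk path (inj₂ (matched-partner-unique unique (matched epw) mxy))
    walk (epw ◅ path) (inj₂ refl) = walk path (inj₁ (matched-partner-unique unique (matched epw) myx))

  α-critical⇒matched : ∀ {E : AdjRel n} {a M u v} → IsAlpha E a → Matching E M → a + length M ≡ n →
    AlphaCritical E u v → Matched M u v
  α-critical⇒matched {E} {a} {M} {u} {v} α≡a matching a+|M|≡n critical with any? (joins? u v) M
  ... | yes matched = matched
  ... | no unmatched with α-exists (deleteEdge E u v)
  ...   | _ , α′≡∣T∣@((T , T-stable , refl) , _) = ⊥-elim (<⇒≱ (critical a ∣ T ∣ α≡a α′≡∣T∣) ∣T∣≤a)
    where
    ∣T∣+|M|≤n : ∣ T ∣ + length M ≤ n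
    ∣T∣+|M|≤n =
      stable+matching≤n {deleteEdge E u v} T-stable (matching-deleteEdge {E} matching unmatched)

    ∣T∣≤a : ∣ T ∣ ≤ a
    ∣T∣≤a = +-cancelʳ-≤ (length M) ∣ T ∣ a (subst (∣ T ∣ + length M ≤_) (sym a+|M|≡n) ∣T∣+|M|≤n)

  complete⇒∣stable∣≤1 : ∀ {E : AdjRel n} {S} → Complete E → Stable E S → ∣ S ∣ ≤ 1
  complete⇒∣stable∣≤1 {E} {S} complete stable = subsingleton⇒∣p∣≤1 S λ x y x∈S y∈S →
    decidable-stable (x ≟ y) λ x≢y → edge⇒≢false {E} (complete x y x≢y) (stable x y x∈S y∈S)

  deleteEdge-stable-ends : ∀ {E : AdjRel n} {u v} → Loopless E →
    Stable (deleteEdge E u v) (⁅ u ⁆ ∪ ⁅ v ⁆)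
  deleteEdge-stable-ends {E} {u} {v} loopless z w z∈ w∈ with x∈⁅y⁆∪⁅z⁆⇒x≡y⊎x≡z z∈ | x∈⁅y⁆∪⁅z⁆⇒x≡y⊎x≡z w∈
  ... | inj₁ refl | inj₁ refl = deleteEdge-loopless {E} loopless u
  ... | inj₁ refl | inj₂ refl = deleteEdge-removes {E} (inj₁ (refl , refl))
  ... | inj₂ refl | inj₁ refl = deleteEdge-removes {E} (inj₂ (refl , refl))
  ... | inj₂ refl | inj₂ refl = deleteEdge-loopless {E} loopless v

  complete⇒α-critical : ∀ {E : AdjRel n} → Loopless E → Complete E → AllEdgesAlphaCritical E
  complete⇒α-critical {E} loopless complete u v euv _ b ((S , S-stable , refl) , _) (_ , maximal) =
    begin-strict
      ∣ S ∣               ≤⟨ complete⇒∣stable∣≤1 {E} complete S-stable ⟩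
      1                   ≡⟨ sym (∣⁅x⁆∣≡1 u) ⟩
      ∣ ⁅ u ⁆ ∣           <⟨ x∉p⇒∣p∣<∣p∪⁅x⁆∣ (x≢y⇒x∉⁅y⁆ (loopless-edge⇒≢ {E} loopless euv ∘ sym)) ⟩
      ∣ ⁅ u ⁆ ∪ ⁅ v ⁆ ∣   ≤⟨ maximal _ (deleteEdge-stable-ends {E} loopless) ⟩
      b                   ∎
    where open ≤-Reasoning

  covered-by-edge⇒complete : ∀ {E : AdjRel n} {x y} → (∀ z w → E z w ≡ E w z) → Edge E x y →
    (∀ z → z ≡ x ⊎ z ≡ y) → Complete E
  covered-by-edge⇒complete symmetric exy covered z w z≢w with covered z | covered w
  ... | inj₁ refl | inj₁ refl = ⊥-elim (z≢w refl)
  ... | inj₁ refl | inj₂ refl = exy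
  ... | inj₂ refl | inj₁ refl = trans (symmetric z w) exy
  ... | inj₂ refl | inj₂ refl = ⊥-elim (z≢w refl)

  Fin2⤖ends : ∀ {x y : Fin n} → x ≢ y → (∀ z → z ≡ x ⊎ z ≡ y) → Fin 2 ⤖ Fin n
  Fin2⤖ends {x} {y} x≢y covered = mk⤖ (injective , surjective)
    where
    ends : Fin 2 → Fin n
    ends zero       = x
    ends (suc zero) = y

    injective : ∀ {i j} → ends i ≡ ends j → i ≡ j
    injective {zero}     {zero}     _   = refl
    injective {zero}     {suc zero} x≡y = ⊥-elim (x≢y x≡y)
    injective {suc zero} {zero}     y≡x = ⊥-elim (x≢y (sym y≡x))
    injective {suc zero} {suc zero} _   = refl

    surjective : ∀ z → ∃ λ i → ∀ {j} → j ≡ i → ends j ≡ z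
    surjective z with covered z
    ... | inj₁ refl = zero , λ { refl → refl }
    ... | inj₂ refl = suc zero , λ { refl → refl }

module _ {n m : ℕ} {E : AdjRel n} {F : AdjRel m} where

  complete-≅ : Loopless E → Complete E → Loopless F → Complete F → Fin n ⤖ Fin m → Isomorphic E F
  complete-≅ loopless-E complete-E loopless-F complete-F f = f , adjacency
    where
    open Bijection f using (to; injective)
    adjacency : ∀ x y → E x y ≡ F (to x) (to y)
    adjacency x y with x ≟ y
    ... | yes refl = trans (loopless-E x) (sym (loopless-F (to x)))
    ... | no x≢y   = trans (complete-E x y x≢y) (sym (complete-F (to x) (to y) (x≢y ∘ injective)))

  ≅-reflects-complete : Isomorphic E F → Complete F → Complete E
  ≅-reflects-complete (f , adjacency) complete-F x y x≢y =
    trans (adjacency x y) (complete-F _ _ (x≢y ∘ Bijection.injective f))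

K₂-loopless : Loopless K₂
K₂-loopless x with x ≟ x
... | yes _   = refl
... | no x≢x = contradiction refl x≢x

K₂-complete : Complete K₂
K₂-complete x y x≢y with x ≟ y
... | yes x≡y = contradiction x≡y x≢y
... | no _    = refl

ke-α-critical⇒≅K₂ : ∀ {n} {E : AdjRel n} → IsGraph E → KonigEgervary E → AllEdgesAlphaCritical E →
  Isomorphic E K₂
ke-α-critical⇒≅K₂ {E = E} ((loopless , symmetric) , connected , x , y , exy)
                  (a , _ , α≡a , ((M , matching , refl) , _) , a+|M|≡n) critical =
  complete-≅ loopless (covered-by-edge⇒complete symmetric exy covered) K₂-loopless K₂-complete
    (sym-≡ (Fin2⤖ends (loopless-edge⇒≢ {E = E} loopless exy) covered))
  where
  matched : ∀ {z w} → Edge E z w → Matched M z w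
  matched ezw = α-critical⇒matched α≡a matching a+|M|≡n (critical _ _ ezw)

  covered : ∀ z → z ≡ x ⊎ z ≡ y
  covered = edges-matched⇒vertices-on-edge connected (proj₂ matching) matched (matched exy)

corollary2p4 : ∀ (n : ℕ) (E : AdjRel n) → IsGraph E → KonigEgervary E →
    (AllEdgesAlphaCritical E ⇔ Isomorphic E K₂)
corollary2p4 n E graph ke = mk⇔ (ke-α-critical⇒≅K₂ graph ke) λ E≅K₂ →
  complete⇒α-critical (proj₁ (proj₁ graph)) (≅-reflects-complete E≅K₂ K₂-complete)
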